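{- For every nonnegative integer $m$, the leading coefficient $c_{m1}$ of the polynomial $f_{m1}(t)$ (defined in the context) equals $(-1)^m$.
   Context: The polynomials $f_{mi}(t)\in\mathbb{Q}[t]$, for integers $m\geqslant 0$ and $0\leqslant i\leqslant m+1$, are defined by $f_{00}(t)=\frac12 t-1$, $f_{01}(t)=1$ and, for $m\geqslant 1$: $f_{m0}(t)=tf_{m-1,0}'(t)$; $f_{m,m+1}(t)=-mf_{m-1,m}(t)$; and $f_{mi}(t)=tf'_{m-1,i}(t)+i(1-t)f_{m-1,i}(t)-(i-1)f_{m-1,i-1}(t)$ for $1\leqslant i\leqslant m$. The polynomial $f_{m1}(t)$ has degree $m$; $c_{m1}$ denotes its coefficient of $t^m$. -}

module Defs where

open import Data.Nat as ℕ using (ℕ; zero; suc; _≤?_)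
open import Data.Nat.Properties using (_≟_)
open import Data.Integer using (+_)
open import Data.List using (List; []; _∷_)
open import Data.Rational using (ℚ; 0ℚ; 1ℚ; ½; -_; _+_; _*_; _/_)
open import Relation.Nullary using (yes; no)

-- Polynomials in ℚ[t] as coefficient lists, lowest degree first:
-- a₀ ∷ a₁ ∷ … ∷ aₙ ∷ [] represents a₀ + a₁ t + … + aₙ tⁿ.
Poly : Set
Poly = List ℚ

coeff : ℕ → Poly → ℚ
coeff n       []      = 0ℚ
coeff zero    (a ∷ p) = a
coeff (suc n) (a ∷ p) = coeff n p

infixr 5 _⊕_
infixr 7 _·_

_⊕_ : Poly → Poly → Poly
[]      ⊕ q       = q
(a ∷ p) ⊕ []      = a ∷ p
(a ∷ p) ⊕ (b ∷ q) = (a + b) ∷ (p ⊕ q)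

_·_ : ℚ → Poly → Poly
c · []      = []
c · (a ∷ p) = (c * a) ∷ (c · p)

X* : Poly → Poly
X* p = 0ℚ ∷ p

ℕ→ℚ : ℕ → ℚ
ℕ→ℚ n = + n / 1

deriv-from : ℕ → Poly → Poly
deriv-from k []      = []
deriv-from k (a ∷ p) = (ℕ→ℚ k * a) ∷ deriv-from (suc k) p

deriv : Poly → Poly
deriv []      = []
deriv (a ∷ p) = deriv-from 1 p

-- f m i = f_{mi}(t); outside the range 0 ≤ i ≤ m+1 it is the zero polynomial
-- (these values are never used by the recursion for in-range indices).
f : ℕ → ℕ → Poly
f zero zero = (- 1ℚ) ∷ ½ ∷ []
f zero (suc zero) = 1ℚ ∷ []
f zero (suc (suc i)) = []
f (suc m) zero = X* (deriv (f m zero))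
f (suc m) (suc j) with suc j ≤? suc m
-- 1 ≤ i = suc j ≤ m+1 (with the new index m' = suc m):
-- t f'_{m'-1,i} + i (1 - t) f_{m'-1,i} - (i-1) f_{m'-1,i-1}
... | yes _ = X* (deriv (f m (suc j)))
              ⊕ ((ℕ→ℚ (suc j) · f m (suc j))
              ⊕ ((- ℕ→ℚ (suc j)) · X* (f m (suc j))
              ⊕ ((- ℕ→ℚ j) · f m j)))
... | no _ with j ≟ suc m
-- i = m'+1:  f_{m',m'+1} = - m' f_{m'-1,m'}
...   | yes _ = (- ℕ→ℚ (suc m)) · f m (suc m)
...   | no _  = []

c : ℕ → ℚ
c m = coeff m (f m 1)

neg1^ : ℕ → ℚ
neg1^ zero    = 1ℚ
neg1^ (suc m) = - neg1^ m

module Submission where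

-- For i = 1 the defining recursion reads f_{m+1,1} = t f'_{m1} + (1 - t) f_{m1}
-- (the term with factor (i - 1) vanishes).  Writing a_n for the coefficient of
-- t^n in f_{m1}, the coefficient of t^{n+1} in f_{m+1,1} is therefore
--     (n + 1) a_{n+1} + a_{n+1} - a_n.  Induction on m gives the degree bound
-- deg f_{m1} ≤ m; with a_{m+1} = 0 the recurrence collapses to
-- c_{m+1,1} = - c_{m1}, and a second induction yields c_{m1} = (-1)^m.

open import Defs
open import Data.Nat using (ℕ; zero; suc; _<_; s≤s)
import Data.Nat as ℕ
import Data.Nat.Properties as ℕ
open import Data.List using ([]; _∷_)
open import Data.Rational using (0ℚ; 1ℚ; -_; _+_; _*_)
open import Data.Rational.Properties
  using (+-identityˡ; +-identityʳ; *-identityˡ; *-zeroˡ; *-zeroʳ; neg-distribˡ-*)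
open import Relation.Binary.PropositionalEquality
open ≡-Reasoning

coeff-⊕ : ∀ n p q → coeff n (p ⊕ q) ≡ coeff n p + coeff n q
coeff-⊕ n       []      q       = sym (+-identityˡ _)
coeff-⊕ n       (a ∷ p) []      = sym (+-identityʳ _)
coeff-⊕ zero    (a ∷ p) (b ∷ q) = refl
coeff-⊕ (suc n) (a ∷ p) (b ∷ q) = coeff-⊕ n p q

coeff-· : ∀ n a p → coeff n (a · p) ≡ a * coeff n p
coeff-· n       a []      = sym (*-zeroʳ a)
coeff-· zero    a (b ∷ p) = refl
coeff-· (suc n) a (b ∷ p) = coeff-· n a p

coeff-deriv-from : ∀ n k p → coeff n (deriv-from k p) ≡ ℕ→ℚ (k ℕ.+ n) * coeff n p
coeff-deriv-from n       k []      = sym (*-zeroʳ (ℕ→ℚ (k ℕ.+ n)))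
coeff-deriv-from zero    k (a ∷ p) =
  cong (λ j → ℕ→ℚ j * a) (sym (ℕ.+-identityʳ k))
coeff-deriv-from (suc n) k (a ∷ p) =
  trans (coeff-deriv-from n (suc k) p)
        (cong (λ j → ℕ→ℚ j * coeff n p) (sym (ℕ.+-suc k n)))

coeff-deriv : ∀ n p → coeff n (deriv p) ≡ ℕ→ℚ (suc n) * coeff (suc n) p
coeff-deriv n []      = sym (*-zeroʳ (ℕ→ℚ (suc n)))
coeff-deriv n (a ∷ p) = coeff-deriv-from n 1 p

-- Coefficient recurrence for f_{m+1,1} = t f'_{m1} + (1 - t) f_{m1}
-- (multiplication by t shifts coefficients, which is definitional for X*).
coeff-f-suc-1 : ∀ m n →
  coeff (suc n) (f (suc m) 1)
    ≡ ℕ→ℚ (suc n) * coeff (suc n) (f m 1) + (coeff (suc n) (f m 1) + - coeff n (f m 1))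
coeff-f-suc-1 m n = begin
    coeff (suc n) (f (suc m) 1)
  ≡⟨ coeff-⊕ (suc n) (X* (deriv p)) (ℕ→ℚ 1 · p ⊕ (- 1ℚ) · X* p ⊕ 0ℚ · f m 0) ⟩
    coeff n (deriv p) + coeff (suc n) (ℕ→ℚ 1 · p ⊕ (- 1ℚ) · X* p ⊕ 0ℚ · f m 0)
  ≡⟨ cong₂ _+_ (coeff-deriv n p) (coeff-⊕ (suc n) (ℕ→ℚ 1 · p) ((- 1ℚ) · X* p ⊕ 0ℚ · f m 0)) ⟩
    ℕ→ℚ (suc n) * b + (coeff (suc n) (1ℚ · p) + coeff (suc n) ((- 1ℚ) · X* p ⊕ 0ℚ · f m 0))
  ≡⟨ cong (λ x → ℕ→ℚ (suc n) * b + (coeff (suc n) (1ℚ · p) + x))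
          (coeff-⊕ (suc n) ((- 1ℚ) · X* p) (0ℚ · f m 0)) ⟩
    ℕ→ℚ (suc n) * b
      + (coeff (suc n) (1ℚ · p) + (coeff (suc n) ((- 1ℚ) · X* p) + coeff (suc n) (0ℚ · f m 0)))
  ≡⟨ cong (λ x → ℕ→ℚ (suc n) * b + x)
          (cong₂ _+_ identity-term (cong₂ _+_ negation-term vanishing-term)) ⟩
    ℕ→ℚ (suc n) * b + (b + (- a + 0ℚ))
  ≡⟨ cong (λ x → ℕ→ℚ (suc n) * b + (b + x)) (+-identityʳ (- a)) ⟩
    ℕ→ℚ (suc n) * b + (b + - a)
  ∎
  where
  p = f m 1
  a = coeff n p
  b = coeff (suc n) p

  identity-term : coeff (suc n) (1ℚ · p) ≡ b
  identity-term = trans (coeff-· (suc n) 1ℚ p) (*-identityˡ b)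

  negation-term : coeff (suc n) ((- 1ℚ) · X* p) ≡ - a
  negation-term = begin
      coeff (suc n) ((- 1ℚ) · X* p) ≡⟨ coeff-· (suc n) (- 1ℚ) (X* p) ⟩
      - 1ℚ * a                      ≡⟨ sym (neg-distribˡ-* 1ℚ a) ⟩
      - (1ℚ * a)                    ≡⟨ cong -_ (*-identityˡ a) ⟩
      - a                           ∎

  -- the term (i - 1) f_{m,i-1} is absent for i = 1
  vanishing-term : coeff (suc n) (0ℚ · f m 0) ≡ 0ℚ
  vanishing-term = trans (coeff-· (suc n) 0ℚ (f m 0)) (*-zeroˡ (coeff (suc n) (f m 0)))

coeff-f-suc-1-top : ∀ m n → coeff (suc n) (f m 1) ≡ 0ℚ →
  coeff (suc n) (f (suc m) 1) ≡ - coeff n (f m 1)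
coeff-f-suc-1-top m n top≡0 = begin
    coeff (suc n) (f (suc m) 1)
  ≡⟨ coeff-f-suc-1 m n ⟩
    ℕ→ℚ (suc n) * coeff (suc n) (f m 1) + (coeff (suc n) (f m 1) + - a)
  ≡⟨ cong (λ x → ℕ→ℚ (suc n) * x + (x + - a)) top≡0 ⟩
    ℕ→ℚ (suc n) * 0ℚ + (0ℚ + - a)
  ≡⟨ cong₂ _+_ (*-zeroʳ (ℕ→ℚ (suc n))) (+-identityˡ (- a)) ⟩
    0ℚ + - a
  ≡⟨ +-identityˡ (- a) ⟩
    - a
  ∎
  where a = coeff n (f m 1)

deg-f-1 : ∀ m n → m < n → coeff n (f m 1) ≡ 0ℚ
deg-f-1 zero    (suc n) _         = refl
deg-f-1 (suc m) (suc n) (s≤s m<n) = begin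
    coeff (suc n) (f (suc m) 1)
  ≡⟨ coeff-f-suc-1-top m n (deg-f-1 m (suc n) (ℕ.m<n⇒m<1+n m<n)) ⟩
    - coeff n (f m 1)
  ≡⟨ cong -_ (deg-f-1 m n m<n) ⟩
    0ℚ
  ∎

corollary2p2 : (m : ℕ) → c m ≡ neg1^ m
corollary2p2 zero    = refl
corollary2p2 (suc m) = begin
    coeff (suc m) (f (suc m) 1)
  ≡⟨ coeff-f-suc-1-top m m (deg-f-1 m (suc m) (ℕ.n<1+n m)) ⟩
    - c m
  ≡⟨ cong -_ (corollary2p2 m) ⟩
    - neg1^ m
  ∎
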